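{- Let $a$ be an integer with $a>2$, $S=\langle a,a+1,a+2\rangle$, and $\ell\in\{0,\dots,a\}$. If $a$ is even, then $S^\ell=\llbracket \ell a,\ell(a+2)\rrbracket$ if $0\le\ell\le\frac a2-1$; $S^\ell=\llbracket \frac a2a,\ (a+1)+(\frac a2-1)(a+2)\rrbracket$ if $\ell=\frac a2$; $S^\ell=\llbracket \frac a2a+(a+1)+(\ell-\frac a2-1)(a+2),\ (\ell-\frac a2)a+(a+1)+(\frac a2-1)(a+2)\rrbracket$ if $\frac a2<\ell\le a$. If $a$ is odd, then $S^\ell=\llbracket \ell a,\ell(a+2)\rrbracket$ if $0\le\ell\le\frac{a-1}2$; $S^\ell=\llbracket (\frac{a-1}2+1)a,\ a+\frac{a-1}2(a+2)\rrbracket$ if $\ell=\frac{a-1}2+1$; $S^\ell=\llbracket (\frac{a-1}2+1)a+(\ell-\frac{a-1}2-1)(a+2),\ (\ell-\frac{a-1}2)a+\frac{a-1}2(a+2)\rrbracket$ if $\frac{a-1}2+1<\ell\le a$.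
   Context: $\mathbb{N}=\{0,1,2,\dots\}$; $S=\langle a,a+1,a+2\rangle=\{\alpha_1a+\alpha_2(a+1)+\alpha_3(a+2):\alpha_i\in\mathbb{N}\}$. For $r\in S$, $\operatorname{F}(r,S)=\{\alpha\in\mathbb{N}^3:\alpha_1a+\alpha_2(a+1)+\alpha_3(a+2)=r\}$, $|\alpha|=\alpha_1+\alpha_2+\alpha_3$, $\operatorname{L}(r,S)=\{|\alpha|:\alpha\in\operatorname{F}(r,S)\}$, and $S^\ell=\{r\in S:\operatorname{L}(r,S)=\{\ell\}\}$. $\llbracket x,y\rrbracket=\{n\in\mathbb{Z}:x\le n\le y\}$. -}

module Defs where

open import Data.Nat using (ℕ; _+_; _*_; _≤_)
open import Data.Product using (Σ; _×_; ∃)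
open import Relation.Binary.PropositionalEquality using (_≡_)

Fact : ℕ → ℕ → ℕ × ℕ × ℕ → Set
Fact a r (α₁ Data.Product., α₂ Data.Product., α₃) =
  α₁ * a + α₂ * (a + 1) + α₃ * (a + 2) ≡ r

len : ℕ × ℕ × ℕ → ℕ
len (α₁ Data.Product., α₂ Data.Product., α₃) = α₁ + α₂ + α₃

InS : ℕ → ℕ → Set
InS a r = ∃ λ α → Fact a r α

InL : ℕ → ℕ → ℕ → Set
InL a r ℓ = ∃ λ α → Fact a r α × len α ≡ ℓ

-- r ∈ S^ℓ, i.e. r ∈ S and L(r,S) = {ℓ}
InSℓ : ℕ → ℕ → ℕ → Set
InSℓ a ℓ r = InS a r × (∀ m → InL a r m → m ≡ ℓ)

InInterval : ℕ → ℕ → ℕ → Set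
InInterval x y r = x ≤ r × r ≤ y

-- A factorization of length m has value m a + (α₂ + 2 α₃), and the excess α₂ + 2 α₃ takes
-- every value in ⟦0, 2m⟧; so m ∈ L(r,S) iff m a ≤ r ≤ m (a+2), and L(r,S) is an interval of
-- lengths. Thus r ∈ S^ℓ iff ℓa ≤ r ≤ ℓ(a+2), r < (ℓ+1)a and (ℓ-1)(a+2) < r. As
-- ℓ(a+2) - (ℓ+1)a = 2ℓ - a, comparing 2ℓ with a decides which of these bounds are redundant:
-- S^ℓ is ⟦ℓa, ℓ(a+2)⟧ for 2ℓ < a, ⟦ℓa, (ℓ+1)a - 1⟧ for a ≤ 2ℓ ≤ a+1, and
-- ⟦(ℓ-1)(a+2) + 1, (ℓ+1)a - 1⟧ for a < 2ℓ.
module Submission where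

open import Defs
open import Data.Nat using (ℕ; zero; suc; _+_; _*_; _∸_; _≤_; _<_; s≤s; s≤s⁻¹; z<s)
open import Data.Empty using (⊥-elim)
open import Data.Nat.Properties
open import Data.Nat.Tactic.RingSolver using (solve-∀)
open import Data.Product using (_×_; _,_)
open import Function.Base using (_∘_)
open import Function.Bundles using (_⇔_; mk⇔; Equivalence)
open import Relation.Nullary using (contradiction)
open import Relation.Binary.Definitions using (tri<; tri≈; tri>)
open import Relation.Binary.PropositionalEquality
  using (_≡_; refl; sym; cong; subst; module ≡-Reasoning)

m*[n+2]≡m*n+2*m : ∀ m n → m * (n + 2) ≡ m * n + 2 * m
m*[n+2]≡m*n+2*m = solve-∀

length-bounds : ∀ {a r} α → Fact a r α → len α * a ≤ r × r ≤ len α * (a + 2)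
length-bounds {a} {r} (x , y , z) f = lower , upper
  where
  open ≤-Reasoning
  lower : (x + y + z) * a ≤ r
  lower = begin
    (x + y + z) * a                    ≤⟨ m≤m+n _ (y + 2 * z) ⟩
    (x + y + z) * a + (y + 2 * z)      ≡⟨ weight a x y z ⟩
    x * a + y * (a + 1) + z * (a + 2)  ≡⟨ f ⟩
    r                                  ∎
    where
    weight : ∀ a x y z → (x + y + z) * a + (y + 2 * z) ≡ x * a + y * (a + 1) + z * (a + 2)
    weight = solve-∀
  upper : r ≤ (x + y + z) * (a + 2)
  upper = begin
    r                                                ≡⟨ f ⟨
    x * a + y * (a + 1) + z * (a + 2)                ≤⟨ m≤m+n _ (2 * x + y) ⟩
    x * a + y * (a + 1) + z * (a + 2) + (2 * x + y)  ≡⟨ weight a x y z ⟩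
    (x + y + z) * (a + 2)                            ∎
    where
    weight : ∀ a x y z → x * a + y * (a + 1) + z * (a + 2) + (2 * x + y) ≡ (x + y + z) * (a + 2)
    weight = solve-∀

factorization-of-length : ∀ a m d → d ≤ 2 * m → InL a (m * a + d) m
factorization-of-length a m zero _ = (m , 0 , 0) , value a m , length m
  where
  value : ∀ a m → m * a + 0 * (a + 1) + 0 * (a + 2) ≡ m * a + 0
  value = solve-∀
  length : ∀ m → m + 0 + 0 ≡ m
  length = solve-∀
factorization-of-length a zero (suc d) ()
factorization-of-length a (suc m) (suc zero) _ = (m , 1 , 0) , value a m , length m
  where
  value : ∀ a m → m * a + 1 * (a + 1) + 0 * (a + 2) ≡ suc m * a + 1
  value = solve-∀
  length : ∀ m → m + 1 + 0 ≡ suc m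
  length = solve-∀
factorization-of-length a (suc m) (suc (suc d)) 2+d≤2[1+m]
  with (x , y , z) , f , refl ← factorization-of-length a m d
         (s≤s⁻¹ (s≤s⁻¹ (subst (2 + d ≤_) (*-suc 2 m) 2+d≤2[1+m])))
  = (x , y , suc z) , value , +-suc (x + y) z
  where
  value : x * a + y * (a + 1) + suc z * (a + 2) ≡ suc (x + y + z) * a + suc (suc d)
  value = begin
    x * a + y * (a + 1) + suc z * (a + 2)          ≡⟨ add-generator a x y z ⟩
    x * a + y * (a + 1) + z * (a + 2) + (a + 2)    ≡⟨ cong (_+ (a + 2)) f ⟩
    (x + y + z) * a + d + (a + 2)                  ≡⟨ regroup a (x + y + z) d ⟩
    suc (x + y + z) * a + suc (suc d)              ∎
    where
    open ≡-Reasoning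
    add-generator : ∀ a x y z →
      x * a + y * (a + 1) + suc z * (a + 2) ≡ x * a + y * (a + 1) + z * (a + 2) + (a + 2)
    add-generator = solve-∀
    regroup : ∀ a m d → m * a + d + (a + 2) ≡ suc m * a + suc (suc d)
    regroup = solve-∀

length-bounds⇒InL : ∀ {a r m} → m * a ≤ r → r ≤ m * (a + 2) → InL a r m
length-bounds⇒InL {a} {m = m} ma≤r r≤m[a+2] with d , refl ← m≤n⇒∃[o]m+o≡n ma≤r =
  factorization-of-length a m d
    (+-cancelˡ-≤ (m * a) d (2 * m) (subst (m * a + d ≤_) (m*[n+2]≡m*n+2*m m a) r≤m[a+2]))

record SoleLength (a ℓ r : ℕ) : Set where
  field
    ℓa≤r       : ℓ * a ≤ r
    r≤ℓ[a+2]   : r ≤ ℓ * (a + 2)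
    no-longer  : ∀ {m} → ℓ < m → r < m * a
    no-shorter : ∀ {m} → m < ℓ → m * (a + 2) < r

InSℓ⇔SoleLength : ∀ {a ℓ r} → InSℓ a ℓ r ⇔ SoleLength a ℓ r
InSℓ⇔SoleLength {a} {ℓ} {r} = mk⇔ to from
  where
  to : InSℓ a ℓ r → SoleLength a ℓ r
  to ((α , f) , unique) = sole (subst (λ m → m * a ≤ r × r ≤ m * (a + 2))
                                      (unique (len α) (α , f , refl)) (length-bounds α f))
    where
    sole : ℓ * a ≤ r × r ≤ ℓ * (a + 2) → SoleLength a ℓ r
    sole (ℓa≤r , r≤ℓ[a+2]) = record
      { ℓa≤r       = ℓa≤r
      ; r≤ℓ[a+2]   = r≤ℓ[a+2]
      ; no-longer  = λ {m} ℓ<m → ≰⇒> λ ma≤r → <⇒≢ ℓ<m (sym (unique m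
          (length-bounds⇒InL ma≤r (≤-trans r≤ℓ[a+2] (*-monoˡ-≤ (a + 2) (<⇒≤ ℓ<m))))))
      ; no-shorter = λ {m} m<ℓ → ≰⇒> λ r≤m[a+2] → <⇒≢ m<ℓ (unique m
          (length-bounds⇒InL (≤-trans (*-monoˡ-≤ a (<⇒≤ m<ℓ)) ℓa≤r) r≤m[a+2]))
      }

  from : SoleLength a ℓ r → InSℓ a ℓ r
  from sole = inS (length-bounds⇒InL ℓa≤r r≤ℓ[a+2]) , unique
    where
    open SoleLength sole
    inS : InL a r ℓ → InS a r
    inS (α , f , _) = α , f
    unique : ∀ m → InL a r m → m ≡ ℓ
    unique m (β , g , refl) with length-bounds β g | <-cmp m ℓ
    ... | _            | tri≈ _ m≡ℓ _ = m≡ℓ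
    ... | _ , r≤m[a+2] | tri< m<ℓ _ _ = contradiction r≤m[a+2] (<⇒≱ (no-shorter m<ℓ))
    ... | ma≤r , _     | tri> _ _ ℓ<m = contradiction ma≤r (<⇒≱ (no-longer ℓ<m))

InSℓ⇔InInterval : ∀ {a ℓ lo hi} →
  (∀ {r} → SoleLength a ℓ r → InInterval lo hi r) →
  (∀ {r} → InInterval lo hi r → SoleLength a ℓ r) →
  ∀ r → InSℓ a ℓ r ⇔ InInterval lo hi r
InSℓ⇔InInterval to from r =
  mk⇔ (to ∘ Equivalence.to InSℓ⇔SoleLength) (Equivalence.from InSℓ⇔SoleLength ∘ from)

≤⇒<-of-suc≡ : ∀ {r n m} → suc n ≡ m → r ≤ n → r < m
≤⇒<-of-suc≡ refl = s≤s

<⇒≤-of-suc≡ : ∀ {r n m} → suc n ≡ m → r < m → r ≤ n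
<⇒≤-of-suc≡ refl = s≤s⁻¹

m*[n+2]<[1+m]*n : ∀ m {n} → 2 * m < n → m * (n + 2) < suc m * n
m*[n+2]<[1+m]*n m {n} 2m<n = begin-strict
  m * (n + 2)    ≡⟨ m*[n+2]≡m*n+2*m m n ⟩
  m * n + 2 * m  <⟨ +-monoʳ-< (m * n) 2m<n ⟩
  m * n + n      ≡⟨ +-comm (m * n) n ⟩
  suc m * n      ∎
  where open ≤-Reasoning

[1+m]*n≤m*[n+2] : ∀ m {n} → n ≤ 2 * m → suc m * n ≤ m * (n + 2)
[1+m]*n≤m*[n+2] m {n} n≤2m = begin
  suc m * n      ≡⟨ +-comm n (m * n) ⟩
  m * n + n      ≤⟨ +-monoʳ-≤ (m * n) n≤2m ⟩
  m * n + 2 * m  ≡⟨ m*[n+2]≡m*n+2*m m n ⟨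
  m * (n + 2)    ∎
  where open ≤-Reasoning

[1+m]*n≤1+m*[n+2] : ∀ m {n} → n ≤ suc (2 * m) → suc m * n ≤ suc (m * (n + 2))
[1+m]*n≤1+m*[n+2] m {n} n≤1+2m = begin
  suc m * n            ≡⟨ +-comm n (m * n) ⟩
  m * n + n            ≤⟨ +-monoʳ-≤ (m * n) n≤1+2m ⟩
  m * n + suc (2 * m)  ≡⟨ +-suc (m * n) (2 * m) ⟩
  suc (m * n + 2 * m)  ≡⟨ cong suc (m*[n+2]≡m*n+2*m m n) ⟨
  suc (m * (n + 2))    ∎
  where open ≤-Reasoning

shorter-excluded : ∀ {a ℓ r m} → 2 * m < a → m < ℓ → ℓ * a ≤ r → m * (a + 2) < r
shorter-excluded {a} {m = m} 2m<a m<ℓ ℓa≤r =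
  <-≤-trans (m*[n+2]<[1+m]*n m 2m<a) (≤-trans (*-monoˡ-≤ a m<ℓ) ℓa≤r)

longer-excluded : ∀ {a ℓ r m} → r < suc ℓ * a → ℓ < m → r < m * a
longer-excluded {a} r<[1+ℓ]a ℓ<m = <-≤-trans r<[1+ℓ]a (*-monoˡ-≤ a ℓ<m)

InSℓ-below-half : ∀ {a ℓ} → 2 * ℓ < a →
  ∀ r → InSℓ a ℓ r ⇔ InInterval (ℓ * a) (ℓ * (a + 2)) r
InSℓ-below-half {a} {ℓ} 2ℓ<a = InSℓ⇔InInterval
  (λ sole → SoleLength.ℓa≤r sole , SoleLength.r≤ℓ[a+2] sole)
  (λ (ℓa≤r , r≤ℓ[a+2]) → record
    { ℓa≤r       = ℓa≤r
    ; r≤ℓ[a+2]   = r≤ℓ[a+2]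
    ; no-longer  = longer-excluded (≤-<-trans r≤ℓ[a+2] (m*[n+2]<[1+m]*n ℓ 2ℓ<a))
    ; no-shorter = λ m<ℓ → shorter-excluded (<-trans (*-monoʳ-< 2 m<ℓ) 2ℓ<a) m<ℓ ℓa≤r
    })

-- hi = (ℓ+1)a - 1 and lo = (ℓ-1)(a+2) + 1, stated as equations to avoid truncated subtraction.
InSℓ-at-half : ∀ {a ℓ hi} → a ≤ 2 * ℓ → 2 * ℓ ≤ suc a → suc hi ≡ suc ℓ * a →
  ∀ r → InSℓ a ℓ r ⇔ InInterval (ℓ * a) hi r
InSℓ-at-half {a} {ℓ} a≤2ℓ 2ℓ≤1+a [1+hi]≡[1+ℓ]a = InSℓ⇔InInterval
  (λ sole → SoleLength.ℓa≤r sole ,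
            <⇒≤-of-suc≡ [1+hi]≡[1+ℓ]a (SoleLength.no-longer sole (n<1+n ℓ)))
  (λ (ℓa≤r , r≤hi) → let r<[1+ℓ]a = ≤⇒<-of-suc≡ [1+hi]≡[1+ℓ]a r≤hi in record
    { ℓa≤r       = ℓa≤r
    ; r≤ℓ[a+2]   = <⇒≤ (<-≤-trans r<[1+ℓ]a ([1+m]*n≤m*[n+2] ℓ a≤2ℓ))
    ; no-longer  = longer-excluded r<[1+ℓ]a
    ; no-shorter = λ m<ℓ → shorter-excluded (2m<a m<ℓ) m<ℓ ℓa≤r
    })
  where
  2m<a : ∀ {m} → m < ℓ → 2 * m < a
  2m<a {m} m<ℓ = s≤s⁻¹ (subst (_≤ suc a) (*-suc 2 m) (≤-trans (*-monoʳ-≤ 2 m<ℓ) 2ℓ≤1+a))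

InSℓ-above-half : ∀ {a ℓ lo hi} →
  a < 2 * ℓ → suc ((ℓ ∸ 1) * (a + 2)) ≡ lo → suc hi ≡ suc ℓ * a →
  ∀ r → InSℓ a ℓ r ⇔ InInterval lo hi r
InSℓ-above-half {ℓ = zero} ()
InSℓ-above-half {a} {suc p} a<2ℓ refl [1+hi]≡[1+ℓ]a = InSℓ⇔InInterval
  (λ sole → SoleLength.no-shorter sole (n<1+n p) ,
            <⇒≤-of-suc≡ [1+hi]≡[1+ℓ]a (SoleLength.no-longer sole (n<1+n (suc p))))
  (λ (p[a+2]<r , r≤hi) → let r<[1+ℓ]a = ≤⇒<-of-suc≡ [1+hi]≡[1+ℓ]a r≤hi in record
    { ℓa≤r       = ≤-trans ([1+m]*n≤1+m*[n+2] p a≤1+2p) p[a+2]<r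
    ; r≤ℓ[a+2]   = <⇒≤ (<-≤-trans r<[1+ℓ]a ([1+m]*n≤m*[n+2] (suc p) (<⇒≤ a<2ℓ)))
    ; no-longer  = longer-excluded r<[1+ℓ]a
    ; no-shorter = λ m<ℓ → ≤-<-trans (*-monoˡ-≤ (a + 2) (s≤s⁻¹ m<ℓ)) p[a+2]<r
    })
  where
  a≤1+2p : a ≤ suc (2 * p)
  a≤1+2p = s≤s⁻¹ (subst (suc a ≤_) (*-suc 2 p) a<2ℓ)

n∸1≡m+[n∸m∸1] : ∀ {m n} → m < n → n ∸ 1 ≡ m + (n ∸ m ∸ 1)
n∸1≡m+[n∸m∸1] {zero}  {suc n}       _           = refl
n∸1≡m+[n∸m∸1] {suc m} {suc (suc n)} (s≤s m<1+n) = cong suc (n∸1≡m+[n∸m∸1] m<1+n)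

even-lower-end : ∀ {k ℓ} → k < ℓ →
  suc ((ℓ ∸ 1) * (2 * k + 2)) ≡ k * (2 * k) + (2 * k + 1) + (ℓ ∸ k ∸ 1) * (2 * k + 2)
even-lower-end {k} {ℓ} k<ℓ = begin
  suc ((ℓ ∸ 1) * (2 * k + 2))
    ≡⟨ cong (λ n → suc (n * (2 * k + 2))) (n∸1≡m+[n∸m∸1] k<ℓ) ⟩
  suc ((k + (ℓ ∸ k ∸ 1)) * (2 * k + 2))
    ≡⟨ identity k (ℓ ∸ k ∸ 1) ⟩
  k * (2 * k) + (2 * k + 1) + (ℓ ∸ k ∸ 1) * (2 * k + 2) ∎
  where
  open ≡-Reasoning
  identity : ∀ k d → suc ((k + d) * (2 * k + 2)) ≡ k * (2 * k) + (2 * k + 1) + d * (2 * k + 2)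
  identity = solve-∀

even-upper-end : ∀ k {ℓ} → suc k ≤ ℓ →
  suc ((ℓ ∸ suc k) * (2 * suc k) + (2 * suc k + 1) + k * (2 * suc k + 2)) ≡ suc ℓ * (2 * suc k)
even-upper-end k {ℓ} 1+k≤ℓ = begin
  suc ((ℓ ∸ suc k) * (2 * suc k) + (2 * suc k + 1) + k * (2 * suc k + 2))
    ≡⟨ identity k (ℓ ∸ suc k) ⟩
  suc (ℓ ∸ suc k + suc k) * (2 * suc k)
    ≡⟨ cong (λ n → suc n * (2 * suc k)) (m∸n+n≡m 1+k≤ℓ) ⟩
  suc ℓ * (2 * suc k) ∎
  where
  open ≡-Reasoning
  identity : ∀ k d →
    suc (d * (2 * suc k) + (2 * suc k + 1) + k * (2 * suc k + 2)) ≡ suc (d + suc k) * (2 * suc k)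
  identity = solve-∀

even-middle-end : ∀ k → suc ((2 * suc k + 1) + k * (2 * suc k + 2)) ≡ suc (suc k) * (2 * suc k)
even-middle-end = solve-∀

odd-lower-end : ∀ {k ℓ} → k < ℓ →
  suc ((ℓ ∸ 1) * (2 * k + 1 + 2)) ≡ (k + 1) * (2 * k + 1) + (ℓ ∸ k ∸ 1) * (2 * k + 1 + 2)
odd-lower-end {k} {ℓ} k<ℓ = begin
  suc ((ℓ ∸ 1) * (2 * k + 1 + 2))
    ≡⟨ cong (λ n → suc (n * (2 * k + 1 + 2))) (n∸1≡m+[n∸m∸1] k<ℓ) ⟩
  suc ((k + (ℓ ∸ k ∸ 1)) * (2 * k + 1 + 2))
    ≡⟨ identity k (ℓ ∸ k ∸ 1) ⟩
  (k + 1) * (2 * k + 1) + (ℓ ∸ k ∸ 1) * (2 * k + 1 + 2) ∎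
  where
  open ≡-Reasoning
  identity : ∀ k d → suc ((k + d) * (2 * k + 1 + 2)) ≡ (k + 1) * (2 * k + 1) + d * (2 * k + 1 + 2)
  identity = solve-∀

odd-upper-end : ∀ {k ℓ} → k ≤ ℓ →
  suc ((ℓ ∸ k) * (2 * k + 1) + k * (2 * k + 1 + 2)) ≡ suc ℓ * (2 * k + 1)
odd-upper-end {k} {ℓ} k≤ℓ = begin
  suc ((ℓ ∸ k) * (2 * k + 1) + k * (2 * k + 1 + 2))
    ≡⟨ identity k (ℓ ∸ k) ⟩
  suc (ℓ ∸ k + k) * (2 * k + 1)
    ≡⟨ cong (λ n → suc n * (2 * k + 1)) (m∸n+n≡m k≤ℓ) ⟩
  suc ℓ * (2 * k + 1) ∎
  where
  open ≡-Reasoning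
  identity : ∀ k d → suc (d * (2 * k + 1) + k * (2 * k + 1 + 2)) ≡ suc (d + k) * (2 * k + 1)
  identity = solve-∀

odd-middle-end : ∀ k → suc ((2 * k + 1) + k * (2 * k + 1 + 2)) ≡ suc (k + 1) * (2 * k + 1)
odd-middle-end = solve-∀

2[k+1]≡2k+1+1 : ∀ k → 2 * (k + 1) ≡ suc (2 * k + 1)
2[k+1]≡2k+1+1 = solve-∀

proposition5p4 : ∀ (a : ℕ) → 2 < a → ∀ (ℓ : ℕ) → ℓ ≤ a →
    (∀ (k : ℕ) → a ≡ 2 * k →
        (ℓ < k → ∀ r → InSℓ a ℓ r ⇔ InInterval (ℓ * a) (ℓ * (a + 2)) r)
      × (ℓ ≡ k → ∀ r → InSℓ a ℓ r ⇔ InInterval (k * a) ((a + 1) + (k ∸ 1) * (a + 2)) r)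
      × (k < ℓ → ∀ r → InSℓ a ℓ r ⇔
            InInterval (k * a + (a + 1) + (ℓ ∸ k ∸ 1) * (a + 2))
                       ((ℓ ∸ k) * a + (a + 1) + (k ∸ 1) * (a + 2)) r))
  × (∀ (k : ℕ) → a ≡ 2 * k + 1 →
        (ℓ ≤ k → ∀ r → InSℓ a ℓ r ⇔ InInterval (ℓ * a) (ℓ * (a + 2)) r)
      × (ℓ ≡ k + 1 → ∀ r → InSℓ a ℓ r ⇔ InInterval ((k + 1) * a) (a + k * (a + 2)) r)
      × (k + 1 < ℓ → ∀ r → InSℓ a ℓ r ⇔
            InInterval ((k + 1) * a + (ℓ ∸ k ∸ 1) * (a + 2))
                       ((ℓ ∸ k) * a + k * (a + 2)) r))
proposition5p4 a 2<a ℓ _ =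
    (λ { zero refl → ⊥-elim (n≮0 2<a)
       ; (suc k) refl →
             (λ ℓ<k → InSℓ-below-half (*-monoʳ-< 2 ℓ<k))
           , (λ { refl → InSℓ-at-half ≤-refl (n≤1+n _) (even-middle-end k) })
           , (λ k<ℓ → InSℓ-above-half (*-monoʳ-< 2 k<ℓ)
                                       (even-lower-end k<ℓ) (even-upper-end k (<⇒≤ k<ℓ))) })
  , (λ { k refl → let 2[k+1]≡a+1 = 2[k+1]≡2k+1+1 k in
             (λ ℓ≤k → InSℓ-below-half (≤-<-trans (*-monoʳ-≤ 2 ℓ≤k) (m<m+n (2 * k) z<s)))
           , (λ { refl → InSℓ-at-half (≤-trans (n≤1+n _) (≤-reflexive (sym 2[k+1]≡a+1)))
                                      (≤-reflexive 2[k+1]≡a+1) (odd-middle-end k) })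
           , (λ k+1<ℓ → let k<ℓ = <-trans (m<m+n k z<s) k+1<ℓ in
                InSℓ-above-half (subst (_≤ 2 * ℓ) 2[k+1]≡a+1 (*-monoʳ-≤ 2 (<⇒≤ k+1<ℓ)))
                                (odd-lower-end k<ℓ) (odd-upper-end (<⇒≤ k<ℓ))) })
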